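{- Let $X',X''$ be disjoint index sets with associated products $\Pi' := \prod X'$ and $\Pi'' := \prod X''$ (each a product of sets indexed by $X'$, resp. $X''$), and suppose a notion of "big subset" is given as described in the context, satisfying rule $(S*1)$: for all $\Sigma'\subseteq\Pi'$, $\Sigma''\subseteq\Pi''$ and $\Delta\subseteq\Sigma'\times\Sigma''$, $\Delta\subseteq\Sigma'\times\Sigma''$ is big iff there are big $\Gamma'\subseteq\Sigma'$ and big $\Gamma''\subseteq\Sigma''$ with $\Gamma'\times\Gamma''\subseteq\Delta$. Then for all $\Gamma'\subseteq\Sigma'\subseteq\Pi'$ and $\Gamma''\subseteq\Sigma''\subseteq\Pi''$: $\Gamma'\times\Gamma''\subseteq\Sigma'\times\Sigma''$ is small iff $\Gamma'\subseteq\Sigma'$ is small or $\Gamma''\subseteq\Sigma''$ is small.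
   Context: For every set $C$ under consideration (subsets of $\Pi'$, of $\Pi''$, and of $\Pi'\times\Pi''$) there is a notion "$A\subseteq C$ is big" such that: if $A\subseteq B\subseteq C$ and $A\subseteq C$ is big then $B\subseteq C$ is big; $C\subseteq C$ is big. $A\subseteq B$ is called small iff $(B-A)\subseteq B$ is big. -}

module Defs where

open import Level using (0ℓ)
open import Data.Product using (_×_; _,_; ∃-syntax)
open import Relation.Nullary using (¬_)
open import Relation.Unary using (Pred; _⊆_; _⟨×⟩_)

Prod : (X : Set) → (X → Set) → Set
Prod X A = (x : X) → A x

Subset : Set → Set₁
Subset C = Pred C 0ℓ

_∖_ : {C : Set} → Subset C → Subset C → Subset C
(B ∖ A) x = B x × ¬ A x

-- A notion of bigness on subsets of a set P:
-- Big A C  means  "A ⊆ C is big".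
record BigNotion (P : Set) : Set₁ where
  field
    Big   : Subset P → Subset P → Set
    mono  : ∀ {A B C : Subset P} → A ⊆ B → B ⊆ C → Big A C → Big B C
    whole : ∀ (C : Subset P) → Big C C

Small : {P : Set} → BigNotion P → Subset P → Subset P → Set
Small N A B = BigNotion.Big N (B ∖ A) B

S*1 : {P′ P″ : Set} → BigNotion P′ → BigNotion P″ → BigNotion (P′ × P″) → Set₁
S*1 {P′} {P″} N′ N″ N =
  ∀ (Σ′ : Subset P′) (Σ″ : Subset P″) (Δ : Subset (P′ × P″)) →
  Δ ⊆ (Σ′ ⟨×⟩ Σ″) →
  (BigNotion.Big N Δ (Σ′ ⟨×⟩ Σ″) →
     ∃[ Γ′ ] ∃[ Γ″ ] (Γ′ ⊆ Σ′ × BigNotion.Big N′ Γ′ Σ′ ×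
                      Γ″ ⊆ Σ″ × BigNotion.Big N″ Γ″ Σ″ ×
                      (Γ′ ⟨×⟩ Γ″) ⊆ Δ))
  × ((∃[ Γ′ ] ∃[ Γ″ ] (Γ′ ⊆ Σ′ × BigNotion.Big N′ Γ′ Σ′ ×
                      Γ″ ⊆ Σ″ × BigNotion.Big N″ Γ″ Σ″ ×
                      (Γ′ ⟨×⟩ Γ″) ⊆ Δ))
     → BigNotion.Big N Δ (Σ′ ⟨×⟩ Σ″))

module Submission where

-- Smallness of Γ ⊆ Σ is bigness of the complement Σ - Γ, so the statement
-- is about the complement of the rectangle,
--   (Σ′ × Σ″) - (Γ′ × Γ″) = ((Σ′ - Γ′) × Σ″) ∪ (Σ′ × (Σ″ - Γ″)).
-- (⇐) If Σ′ - Γ′ is big then the rectangle (Σ′ - Γ′) × Σ″ (with Σ″ ⊆ Σ″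
--     big) lies in the complement, which is therefore big by (S*1);
--     symmetrically for the second side.
-- (⇒) By (S*1) the big complement contains a product G′ × G″ of big sets.
--     Classically, either G′ misses Γ′ or G″ misses Γ″ (else a common point
--     of the two would lie both in G′ × G″ and in Γ′ × Γ″); a big set missing
--     Γ witnesses that Γ is small, by upward closure of bigness.
-- All lemmas are stated for arbitrary carriers.

open import Defs
open import Level using (0ℓ)
open import Axiom.ExcludedMiddle using (ExcludedMiddle)
open import Data.Empty using (⊥-elim)
open import Data.Product using (_×_; _,_; proj₁; proj₂; ∃-syntax)
open import Data.Sum using (_⊎_; inj₁; inj₂)
open import Relation.Nullary using (¬_; yes; no)
open import Relation.Unary using (_⊆_; _⟨×⟩_)

big-disjoint⇒small : {P : Set} (N : BigNotion P) {Γ Σ G : Subset P} →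
  G ⊆ Σ → BigNotion.Big N G Σ → (∀ {a} → G a → ¬ Γ a) → Small N Γ Σ
big-disjoint⇒small N G⊆Σ big disj =
  BigNotion.mono N (λ g → G⊆Σ g , disj g) proj₁ big

product-disjoint⇒side-disjoint : ExcludedMiddle 0ℓ → {P′ P″ : Set}
  (G′ Γ′ : Subset P′) (G″ Γ″ : Subset P″) →
  (∀ {a b} → G′ a → G″ b → ¬ (Γ′ a × Γ″ b)) →
  (∀ {a} → G′ a → ¬ Γ′ a) ⊎ (∀ {b} → G″ b → ¬ Γ″ b)
product-disjoint⇒side-disjoint em G′ Γ′ G″ Γ″ disj
  with em {∃[ a ] (G′ a × Γ′ a)}
... | no noCommon′ = inj₁ (λ {a} g γ → noCommon′ (a , g , γ))
... | yes (a , ga , γa) with em {∃[ b ] (G″ b × Γ″ b)}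
...   | no noCommon″ = inj₂ (λ {b} g γ → noCommon″ (b , g , γ))
...   | yes (b , gb , γb) = ⊥-elim (disj ga gb (γa , γb))

module _ {P′ P″ : Set} (N′ : BigNotion P′) (N″ : BigNotion P″)
         (N : BigNotion (P′ × P″)) (s1 : S*1 N′ N″ N)
         (Γ′ Σ′ : Subset P′) (Γ″ Σ″ : Subset P″) where

  Co : Subset (P′ × P″)
  Co = (Σ′ ⟨×⟩ Σ″) ∖ (Γ′ ⟨×⟩ Γ″)

  small-rectangle⇒small-side : ExcludedMiddle 0ℓ →
    Small N (Γ′ ⟨×⟩ Γ″) (Σ′ ⟨×⟩ Σ″) → Small N′ Γ′ Σ′ ⊎ Small N″ Γ″ Σ″
  small-rectangle⇒small-side em small
    with proj₁ (s1 Σ′ Σ″ Co proj₁) small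
  ... | G′ , G″ , G′⊆Σ′ , bigG′ , G″⊆Σ″ , bigG″ , G′×G″⊆Co
    with product-disjoint⇒side-disjoint em G′ Γ′ G″ Γ″
           (λ g′ g″ → proj₂ (G′×G″⊆Co (g′ , g″)))
  ... | inj₁ misses′ = inj₁ (big-disjoint⇒small N′ G′⊆Σ′ bigG′ misses′)
  ... | inj₂ misses″ = inj₂ (big-disjoint⇒small N″ G″⊆Σ″ bigG″ misses″)

  -- (⇐): a small side makes the rectangle small, since the complement of
  -- that side times the other whole side is a big rectangle inside Co.
  small-side⇒small-rectangle :
    Small N′ Γ′ Σ′ ⊎ Small N″ Γ″ Σ″ → Small N (Γ′ ⟨×⟩ Γ″) (Σ′ ⟨×⟩ Σ″)
  small-side⇒small-rectangle (inj₁ small′) =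
    proj₂ (s1 Σ′ Σ″ Co proj₁)
      (Σ′ ∖ Γ′ , Σ″ , proj₁ , small′ , (λ s → s) , BigNotion.whole N″ Σ″ ,
       λ { ((s′ , ¬γ′) , s″) → (s′ , s″) , λ { (γ′ , _) → ¬γ′ γ′ } })
  small-side⇒small-rectangle (inj₂ small″) =
    proj₂ (s1 Σ′ Σ″ Co proj₁)
      (Σ′ , Σ″ ∖ Γ″ , (λ s → s) , BigNotion.whole N′ Σ′ , proj₁ , small″ ,
       λ { (s′ , (s″ , ¬γ″)) → (s′ , s″) , λ { (_ , γ″) → ¬γ″ γ″ } })

fact4p3 : ExcludedMiddle 0ℓ →
    (X′ : Set) (A′ : X′ → Set) (X″ : Set) (A″ : X″ → Set) →
    (N′ : BigNotion (Prod X′ A′)) (N″ : BigNotion (Prod X″ A″)) →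
    (N : BigNotion (Prod X′ A′ × Prod X″ A″)) →
    S*1 N′ N″ N →
    ∀ (Γ′ Σ′ : Subset (Prod X′ A′)) (Γ″ Σ″ : Subset (Prod X″ A″)) →
    Γ′ ⊆ Σ′ → Γ″ ⊆ Σ″ →
    (Small N (Γ′ ⟨×⟩ Γ″) (Σ′ ⟨×⟩ Σ″) → Small N′ Γ′ Σ′ ⊎ Small N″ Γ″ Σ″)
    × (Small N′ Γ′ Σ′ ⊎ Small N″ Γ″ Σ″ → Small N (Γ′ ⟨×⟩ Γ″) (Σ′ ⟨×⟩ Σ″))
fact4p3 em _ _ _ _ N′ N″ N s1 Γ′ Σ′ Γ″ Σ″ _ _ =
  small-rectangle⇒small-side N′ N″ N s1 Γ′ Σ′ Γ″ Σ″ em ,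
  small-side⇒small-rectangle N′ N″ N s1 Γ′ Σ′ Γ″ Σ″
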